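{- In the game \textsc{saliquant}, let $p\geq 5$ be prime. If $x$ is an option of $2p$ with $\mathcal{SG}(x)=\frac{p-1}{2}$, then $x=p+1$. Hence: if $\mathcal{SG}(p+1)=\frac{p-1}{2}$ then $\mathcal{SG}(2p)=p-1$; and if $\mathcal{SG}(p+1)\neq\frac{p-1}{2}$ then $\mathcal{SG}(2p)=\frac{p-1}{2}$.
   Context: \textsc{saliquant} is the normal-play impartial game whose positions are the positive integers, where the options of a position $n\geq 1$ are $\{n-k : 1\leq k\leq n,\ k\nmid n\}$. The nim-value is defined recursively by $\mathcal{SG}(n)=\operatorname{mex}\{\mathcal{SG}(x) : x \text{ an option of } n\}$, where $\operatorname{mex}(A)$ is the least nonnegative integer not in $A$. -}

module Defs where

open import Data.Nat using (ℕ; zero; suc; _+_; _∸_; _≤_; _<_)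
open import Data.Nat.Divisibility using (_∣_; _∣?_)
open import Data.List using (List; []; _∷_; length)
open import Data.List.Membership.DecPropositional Data.Nat._≟_ using (_∈?_)
open import Relation.Nullary using (¬_; yes; no)
open import Data.Product using (∃; _×_)
open import Relation.Binary.PropositionalEquality using (_≡_)

-- mex of a finite list: least natural not in the list.
-- mexFrom A m fuel searches m, m+1, ..., m+fuel; since at most (length A)
-- numbers are excluded, fuel = length A suffices starting from 0.
mexFrom : List ℕ → ℕ → ℕ → ℕ
mexFrom A m zero = m
mexFrom A m (suc fuel) with m ∈? A
... | yes _ = mexFrom A (suc m) fuel
... | no  _ = m

mex : List ℕ → ℕ
mex A = mexFrom A 0 (length A)

-- Given ts = [SG(n-1), SG(n-2), ..., SG(0)] (so the (k-1)-th entry is SG(n-k)),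
-- collect SG(n-k) for 1 ≤ k ≤ n with k ∤ n.
optVals : ℕ → ℕ → List ℕ → List ℕ
optVals n k [] = []
optVals n k (t ∷ ts) with k ∣? n
... | yes _ = optVals n (suc k) ts
... | no  _ = t ∷ optVals n (suc k) ts

-- table n = [SG(n-1), ..., SG(0)]   (position 0 is not a game position;
-- it is never an option since k = n always divides n; its entry is unused)
table : ℕ → List ℕ
table zero = []
table (suc n) = mex (optVals n 1 (table n)) ∷ table n

SG : ℕ → ℕ
SG n = mex (optVals n 1 (table n))

IsOption : ℕ → ℕ → Set
IsOption n x = ∃ λ k → 1 ≤ k × k ≤ n × ¬ (k ∣ n) × x ≡ n ∸ k

module Submission where

-- Since the move k = 1 is always illegal, every move removes at least 2, and induction gives
-- 2 SG(n) < n.  Consequently SG(1 + 2h) = h: each smaller value v is reached by removing the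
-- even number 2(h - v), which cannot divide an odd position.  Now let p = 1 + 2h be prime.  The
-- options 1 + 2v of 2p with v < 2h, v ≠ h, are reached by odd moves other than 1 and p, which do
-- not divide 2p; so they supply every value below 2h except h.  An option x of 2p of value h
-- satisfies x ≥ p by the bound; x = p would need the move p, and for x ≥ p + 2 the position p,
-- of value h, is itself an option of x (the move x - p < p cannot divide x).  So x = p + 1.
-- Finally p + 1 is reached by the move p - 1 = 2h, while no option has value 2h by the bound.

open import Defs
open import Data.Nat using (ℕ; zero; suc; _≤_; _<_; _*_; _+_; _∸_; _/_; z≤n; s≤s; _≟_)
open import Data.Nat.Properties
open import Data.Nat.Divisibility
  using (_∣_; divides; _∣?_; 1∣_; n∣n; ∣-trans; ∣⇒≤; m∣m*n; n∣m*n; ∣m+n∣m⇒∣n; *-cancelˡ-∣)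
open import Data.Nat.DivMod using (m*n/n≡m)
open import Data.Nat.Primality using (Prime; prime[2]; prime⇒irreducible; prime⇒nonZero)
open import Data.Nat.Coprimality using (Coprime; coprime-divisor)
open import Data.Nat.Induction using (<-rec)
open import Data.Nat.Tactic.RingSolver using (solve-∀)
open import Data.List using (List; length)
open import Data.List.Properties using (length-removeAt′)
open import Data.List.Relation.Unary.Any using (here; there; index)
open import Data.List.Membership.Propositional using (_∈_; _∉_; _─_)
open import Data.List.Membership.DecPropositional _≟_ using (_∈?_)
open import Data.Product using (_×_; _,_; ∃-syntax)
open import Data.Sum using (_⊎_; inj₁; inj₂)
open import Relation.Binary.Definitions using (tri<; tri≈; tri>)
open import Relation.Nullary using (¬_; yes; no; contradiction)
open import Relation.Binary.PropositionalEquality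
  using (_≡_; _≢_; refl; sym; trans; cong; subst; subst₂)

∈-─ : ∀ {x y} {xs : List ℕ} (y∈xs : y ∈ xs) → x ∈ xs → x ≢ y → x ∈ xs ─ y∈xs
∈-─ (here refl) (here refl) x≢y = contradiction refl x≢y
∈-─ (here _)    (there x∈xs) _  = x∈xs
∈-─ (there _)   (here x≡z)   _  = here x≡z
∈-─ (there y∈xs) (there x∈xs) x≢y = there (∈-─ y∈xs x∈xs x≢y)

∀<∈⇒≤length : ∀ t (xs : List ℕ) → (∀ v → v < t → v ∈ xs) → t ≤ length xs
∀<∈⇒≤length zero    xs below = z≤n
∀<∈⇒≤length (suc t) xs below =
  subst (suc t ≤_) (sym (length-removeAt′ xs (index t∈xs)))
    (s≤s (∀<∈⇒≤length t (xs ─ t∈xs)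
      (λ v v<t → ∈-─ t∈xs (below v (m<n⇒m<1+n v<t)) (<⇒≢ v<t))))
  where t∈xs = below t ≤-refl

∀<∈-suc : ∀ {m} {xs : List ℕ} → (∀ v → v < m → v ∈ xs) → m ∈ xs → ∀ v → v < suc m → v ∈ xs
∀<∈-suc {m} below m∈xs v (s≤s v≤m) with v ≟ m
... | yes refl = m∈xs
... | no v≢m   = below v (≤∧≢⇒< v≤m v≢m)

mexFrom-minimal : ∀ xs m fuel v → m ≤ v → v < mexFrom xs m fuel → v ∈ xs
mexFrom-minimal xs m zero v m≤v v<r = contradiction m≤v (<⇒≱ v<r)
mexFrom-minimal xs m (suc fuel) v m≤v v<r with m ∈? xs
... | no _ = contradiction m≤v (<⇒≱ v<r)
... | yes m∈xs with m ≟ v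
...   | yes refl = m∈xs
...   | no m≢v   = mexFrom-minimal xs (suc m) fuel v (≤∧≢⇒< m≤v m≢v) v<r

-- Enough fuel: once all of 0, …, m are in xs, pigeonhole forces m < length xs.
mexFrom-∉ : ∀ xs m fuel → (∀ v → v < m → v ∈ xs) → m + fuel ≡ length xs → mexFrom xs m fuel ∉ xs
mexFrom-∉ xs m zero below m≡len m∈xs =
  <-irrefl (trans (sym (+-identityʳ m)) m≡len)
    (∀<∈⇒≤length (suc m) xs (∀<∈-suc below m∈xs))
mexFrom-∉ xs m (suc fuel) below m+fuel≡len with m ∈? xs
... | no m∉xs  = m∉xs
... | yes m∈xs = mexFrom-∉ xs (suc m) fuel (∀<∈-suc below m∈xs) (trans (sym (+-suc m fuel)) m+fuel≡len)

<mex⇒∈ : ∀ xs v → v < mex xs → v ∈ xs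
<mex⇒∈ xs v = mexFrom-minimal xs 0 (length xs) v z≤n

mex∉ : ∀ xs → mex xs ∉ xs
mex∉ xs = mexFrom-∉ xs 0 (length xs) (λ _ ()) refl

mex≡ : ∀ xs t → (∀ v → v < t → v ∈ xs) → t ∉ xs → mex xs ≡ t
mex≡ xs t below t∉xs with <-cmp (mex xs) t
... | tri< mex<t _ _ = contradiction (below _ mex<t) (mex∉ xs)
... | tri≈ _ mex≡t _ = mex≡t
... | tri> _ _ t<mex = contradiction (<mex⇒∈ xs t t<mex) t∉xs

optionValues : ℕ → List ℕ
optionValues n = optVals n 1 (table n)

-- table m ≡ SG (m ∸ 1) ∷ …, and m ∸ 1 ≡ n ∸ k when k + m ≡ suc n.
private
  next-offset : ∀ {n k m} → k + suc m ≡ suc n → suc k + m ≡ suc n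
  next-offset {k = k} {m} eq = trans (sym (+-suc k m)) eq

  head-position : ∀ {n k m} → k + suc m ≡ suc n → n ∸ k ≡ m
  head-position {k = k} {m} eq = trans (cong (_∸ k) (sym (suc-injective (next-offset eq)))) (m+n∸m≡n k m)

optVals-sound : ∀ n k m v → k + m ≡ suc n → v ∈ optVals n k (table m) →
  ∃[ j ] k ≤ j × j ≤ n × ¬ j ∣ n × v ≡ SG (n ∸ j)
optVals-sound n k (suc m) v eq v∈ with k ∣? n
optVals-sound n k (suc m) v eq v∈ | yes _
  with j , k<j , rest ← optVals-sound n (suc k) m v (next-offset eq) v∈ = j , <⇒≤ k<j , rest
optVals-sound n k (suc m) v eq (here refl) | no k∤n =
  k , ≤-refl , m+n≤o⇒m≤o k (≤-reflexive (suc-injective (next-offset eq))) , k∤n ,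
  cong SG (sym (head-position eq))
optVals-sound n k (suc m) v eq (there v∈) | no _
  with j , k<j , rest ← optVals-sound n (suc k) m v (next-offset eq) v∈ = j , <⇒≤ k<j , rest

optVals-complete : ∀ n k m j → k + m ≡ suc n → k ≤ j → j ≤ n → ¬ j ∣ n →
  SG (n ∸ j) ∈ optVals n k (table m)
optVals-complete n k zero j eq k≤j j≤n _ =
  contradiction (≤-trans (≤-reflexive (trans (sym eq) (+-identityʳ k))) k≤j) (<⇒≱ (s≤s j≤n))
optVals-complete n k (suc m) j eq k≤j j≤n j∤n with k ∣? n | k ≟ j
... | yes k∣n | yes refl = contradiction k∣n j∤n
... | yes _   | no k≢j   = optVals-complete n (suc k) m j (next-offset eq) (≤∧≢⇒< k≤j k≢j) j≤n j∤n
... | no _    | yes refl = here (cong SG (head-position eq))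
... | no _    | no k≢j   = there (optVals-complete n (suc k) m j (next-offset eq) (≤∧≢⇒< k≤j k≢j) j≤n j∤n)

∈optionValues⇒option : ∀ n v → v ∈ optionValues n → ∃[ x ] IsOption n x × SG x ≡ v
∈optionValues⇒option n v v∈
  with j , 1≤j , j≤n , j∤n , refl ← optVals-sound n 1 n v refl v∈ =
  n ∸ j , (j , 1≤j , j≤n , j∤n , refl) , refl

option⇒∈optionValues : ∀ n x → IsOption n x → SG x ∈ optionValues n
option⇒∈optionValues n x (k , 1≤k , k≤n , k∤n , refl) = optVals-complete n 1 n k refl 1≤k k≤n k∤n

SG-option-≢ : ∀ {n x} → IsOption n x → SG x ≢ SG n
SG-option-≢ {n} {x} opt SGx≡SGn =
  mex∉ (optionValues n) (subst (_∈ optionValues n) SGx≡SGn (option⇒∈optionValues n x opt))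

<SG⇒option : ∀ {n v} → v < SG n → ∃[ x ] IsOption n x × SG x ≡ v
<SG⇒option {n} {v} v<SG = ∈optionValues⇒option n v (<mex⇒∈ (optionValues n) v v<SG)

SG≡ : ∀ n t → (∀ v → v < t → ∃[ x ] IsOption n x × SG x ≡ v) →
  (∀ x → IsOption n x → SG x ≢ t) → SG n ≡ t
SG≡ n t attained avoided = mex≡ (optionValues n) t below t∉
  where
  below : ∀ v → v < t → v ∈ optionValues n
  below v v<t with x , opt , refl ← attained v v<t = option⇒∈optionValues n x opt
  t∉ : t ∉ optionValues n
  t∉ t∈ with x , opt , SGx≡t ← ∈optionValues⇒option n t t∈ = avoided x opt SGx≡t

mkOption : ∀ {n x k} → x + k ≡ n → 0 < k → ¬ k ∣ n → IsOption n x
mkOption {n} {x} {k} x+k≡n 0<k k∤n =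
  k , 0<k , subst (k ≤_) x+k≡n (m≤n+m k x) , k∤n , sym (trans (cong (_∸ k) (sym x+k≡n)) (m+n∸n≡m x k))

option⇒+ : ∀ {n x} → IsOption n x → ∃[ k ] x + k ≡ n × 1 < k × ¬ k ∣ n
option⇒+ {n} (k , 1≤k , k≤n , k∤n , refl) = k , m∸n+n≡m k≤n , ≤∧≢⇒< 1≤k k≢1 , k∤n
  where
  k≢1 : 1 ≢ k
  k≢1 refl = k∤n (1∣ n)

option⇒0< : ∀ {n x} → IsOption n x → 0 < x
option⇒0< {x = zero}  opt with k , refl , _ , k∤k ← option⇒+ opt = contradiction n∣n k∤k
option⇒0< {x = suc x} opt = s≤s z≤n

option⇒+2≤ : ∀ {n x} → IsOption n x → x + 2 ≤ n
option⇒+2≤ {x = x} opt with k , refl , 1<k , _ ← option⇒+ opt = +-monoʳ-≤ x 1<k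

2*SG< : ∀ n → 0 < n → 2 * SG n < n
2*SG< = <-rec (λ n → 0 < n → 2 * SG n < n) step
  where
  step : ∀ n → (∀ {y} → y < n → 0 < y → 2 * SG y < y) → 0 < n → 2 * SG n < n
  step n ih 0<n with SG n in SGn≡
  ... | zero = 0<n
  ... | suc w with x , opt , refl ← <SG⇒option {n} (subst (w <_) (sym SGn≡) (n<1+n w)) = begin-strict
    2 * suc (SG x) ≡⟨ *-suc 2 (SG x) ⟩
    2 + 2 * SG x   <⟨ +-monoʳ-< 2 (ih (<-≤-trans (m<m+n x (s≤s z≤n)) x+2≤n) (option⇒0< opt)) ⟩
    2 + x          ≡⟨ +-comm 2 x ⟩
    x + 2          ≤⟨ x+2≤n ⟩
    n              ∎
    where
    open ≤-Reasoning
    x+2≤n = option⇒+2≤ opt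

option-SG-bound : ∀ {n x} → IsOption n x → 2 * SG x + 2 < n
option-SG-bound {x = x} opt = <-≤-trans (+-monoˡ-< 2 (2*SG< x (option⇒0< opt))) (option⇒+2≤ opt)

2∤1+2* : ∀ h → ¬ 2 ∣ 1 + 2 * h
2∤1+2* h (divides q 1+2h≡q*2) = even≢odd q h (trans (*-comm 2 q) (sym 1+2h≡q*2))

SG-odd : ∀ h → SG (1 + 2 * h) ≡ h
SG-odd = <-rec (λ h → SG (1 + 2 * h) ≡ h) λ h ih → SG≡ (1 + 2 * h) h (attained ih) avoided
  where
  shift : ∀ v o → 1 + 2 * v + 2 * suc o ≡ 1 + 2 * (suc v + o)
  shift = solve-∀

  attained : ∀ {h} → (∀ {v} → v < h → SG (1 + 2 * v) ≡ v) →
    ∀ v → v < h → ∃[ x ] IsOption (1 + 2 * h) x × SG x ≡ v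
  attained {h} ih v v<h with o , v+o≡h ← m≤n⇒∃[o]m+o≡n v<h =
    1 + 2 * v , mkOption (trans (shift v o) (cong (λ m → 1 + 2 * m) v+o≡h)) (s≤s z≤n)
                  (λ k∣n → 2∤1+2* h (∣-trans (m∣m*n (suc o)) k∣n)) ,
    ih v<h

  avoided : ∀ {h} x → IsOption (1 + 2 * h) x → SG x ≢ h
  avoided {h} x opt refl = m+1+n≰m (2 * h) (≤-pred (option-SG-bound opt))

prime-∤ : ∀ {p d} → Prime p → 1 < d → d < p → ¬ d ∣ p
prime-∤ p-prime 1<d d<p d∣p with prime⇒irreducible p-prime d∣p
... | inj₁ refl = <-irrefl refl 1<d
... | inj₂ refl = <-irrefl refl d<p

prime-option : ∀ {p d} → Prime p → 1 < d → d < p → IsOption (p + d) p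
prime-option {p} {d} p-prime 1<d d<p =
  mkOption refl (<-trans (s≤s z≤n) 1<d) λ d∣p+d →
    prime-∤ p-prime 1<d d<p (∣m+n∣m⇒∣n (subst (d ∣_) (+-comm p d) d∣p+d) n∣n)

odd⇒coprime-2 : ∀ {k} → ¬ 2 ∣ k → Coprime k 2
odd⇒coprime-2 2∤k (i∣k , i∣2) with prime⇒irreducible prime[2] i∣2
... | inj₁ i≡1 = i≡1
... | inj₂ refl = contradiction i∣k 2∤k

odd-∤-2*prime : ∀ {p k} → Prime p → ¬ 2 ∣ k → 1 < k → k ≢ p → ¬ k ∣ 2 * p
odd-∤-2*prime {p} {k} p-prime 2∤k 1<k k≢p k∣2p =
  prime-∤ p-prime 1<k (≤∧≢⇒< (∣⇒≤ ⦃ prime⇒nonZero p-prime ⦄ k∣p) k≢p) k∣p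
  where k∣p = coprime-divisor (odd⇒coprime-2 2∤k) k∣2p

+≡2*-cancelˡ : ∀ {n k} → n + k ≡ 2 * n → k ≡ n
+≡2*-cancelˡ {n} {k} n+k≡2n = +-cancelˡ-≡ n k n (trans n+k≡2n (cong (n +_) (+-identityʳ n)))

+≡2*-cancelʳ : ∀ {n x} → x + n ≡ 2 * n → x ≡ n
+≡2*-cancelʳ {n} {x} x+n≡2n = +≡2*-cancelˡ (trans (+-comm n x) x+n≡2n)

private
  odd+odd : ∀ v o → 1 + 2 * v + (1 + 2 * suc o) ≡ 2 * (1 + (suc v + o))
  odd+odd = solve-∀

  p+1+[p∸1]≡2p : ∀ h → 1 + 2 * h + 1 + 2 * h ≡ 2 * (1 + 2 * h)
  p+1+[p∸1]≡2p = solve-∀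

  2p≡2[p∸1]+2 : ∀ h → 2 * (1 + 2 * h) ≡ 2 * (2 * h) + 2
  2p≡2[p∸1]+2 = solve-∀

module TwicePrime (h : ℕ) (p-prime : Prime (1 + 2 * h)) (2≤h : 2 ≤ h) where

  p : ℕ
  p = 1 + 2 * h

  h≤2h : h ≤ 2 * h
  h≤2h = m≤m+n h (h + 0)

  odd-option : ∀ v → v < 2 * h → v ≢ h → IsOption (2 * p) (1 + 2 * v)
  odd-option v v<2h v≢h with o , v+o≡2h ← m≤n⇒∃[o]m+o≡n v<2h =
    mkOption x+k≡2p (s≤s z≤n) (odd-∤-2*prime p-prime (2∤1+2* (suc o)) (s≤s (s≤s z≤n)) k≢p)
    where
    x+k≡2p : 1 + 2 * v + (1 + 2 * suc o) ≡ 2 * p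
    x+k≡2p = trans (odd+odd v o) (cong (λ m → 2 * (1 + m)) v+o≡2h)
    k≢p : 1 + 2 * suc o ≢ p
    k≢p k≡p = v≢h (*-cancelˡ-≡ v h 2 (suc-injective
      (+≡2*-cancelʳ (subst (λ k → 1 + 2 * v + k ≡ 2 * p) k≡p x+k≡2p))))

  p+1-option : IsOption (2 * p) (p + 1)
  p+1-option = mkOption (p+1+[p∸1]≡2p h) (≤-trans (≤-trans (s≤s z≤n) 2≤h) h≤2h)
    (λ 2h∣2p → prime-∤ p-prime 2≤h (s≤s h≤2h) (*-cancelˡ-∣ 2 2h∣2p))

  beyond-p : ∀ d k → p + d + k ≡ 2 * p → 0 < k → ¬ k ∣ 2 * p → SG (p + d) ≡ h → d ≡ 1
  beyond-p zero k x+k≡2p _ k∤2p _ =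
    contradiction (subst (_∣ 2 * p) (sym k≡p) (n∣m*n 2)) k∤2p
    where k≡p = +≡2*-cancelˡ (trans (cong (_+ k) (sym (+-identityʳ p))) x+k≡2p)
  beyond-p 1 _ _ _ _ _ = refl
  beyond-p d@(suc (suc _)) k x+k≡2p 0<k _ SGx≡h =
    contradiction (trans (SG-odd h) (sym SGx≡h)) (SG-option-≢ (prime-option p-prime (s≤s (s≤s z≤n)) d<p))
    where
    d+k≡p : d + k ≡ p
    d+k≡p = +≡2*-cancelˡ (trans (sym (+-assoc p d k)) x+k≡2p)
    d<p : d < p
    d<p = subst (d <_) d+k≡p (m<m+n d 0<k)

  SG≡h⇒≡p+1 : ∀ x → IsOption (2 * p) x → SG x ≡ h → x ≡ p + 1
  SG≡h⇒≡p+1 x opt SGx≡h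
    with k , x+k≡2p , 1<k , k∤2p ← option⇒+ opt
       | d , refl ← m≤n⇒∃[o]m+o≡n (subst (λ s → 2 * s < x) SGx≡h (2*SG< x (option⇒0< opt)))
    = cong (p +_) (beyond-p d k x+k≡2p (<-trans (s≤s z≤n) 1<k) k∤2p SGx≡h)

  SG[2p]≡h : SG (p + 1) ≢ h → SG (2 * p) ≡ h
  SG[2p]≡h SG[p+1]≢h = SG≡ (2 * p) h attained avoided
    where
    attained : ∀ v → v < h → ∃[ x ] IsOption (2 * p) x × SG x ≡ v
    attained v v<h = 1 + 2 * v , odd-option v (<-≤-trans v<h h≤2h) (<⇒≢ v<h) , SG-odd v
    avoided : ∀ x → IsOption (2 * p) x → SG x ≢ h
    avoided x opt SGx≡h = SG[p+1]≢h (subst (λ y → SG y ≡ h) (SG≡h⇒≡p+1 x opt SGx≡h) SGx≡h)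

  SG[2p]≡2h : SG (p + 1) ≡ h → SG (2 * p) ≡ 2 * h
  SG[2p]≡2h SG[p+1]≡h = SG≡ (2 * p) (2 * h) attained avoided
    where
    attained : ∀ v → v < 2 * h → ∃[ x ] IsOption (2 * p) x × SG x ≡ v
    attained v v<2h with v ≟ h
    ... | yes refl = p + 1 , p+1-option , SG[p+1]≡h
    ... | no v≢h   = 1 + 2 * v , odd-option v v<2h v≢h , SG-odd v
    avoided : ∀ x → IsOption (2 * p) x → SG x ≢ 2 * h
    avoided x opt SGx≡2h = <-irrefl refl
      (subst₂ (λ s t → 2 * s + 2 < t) SGx≡2h (2p≡2[p∸1]+2 h) (option-SG-bound opt))

even⊎odd : ∀ n → (∃[ h ] n ≡ 2 * h) ⊎ (∃[ h ] n ≡ 1 + 2 * h)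
even⊎odd zero = inj₁ (0 , refl)
even⊎odd (suc n) with even⊎odd n
... | inj₁ (h , refl) = inj₂ (h , refl)
... | inj₂ (h , refl) = inj₁ (suc h , sym (*-suc 2 h))

prime≥5⇒odd : ∀ {p} → Prime p → 5 ≤ p → ∃[ h ] p ≡ 1 + 2 * h × 2 ≤ h
prime≥5⇒odd {p} p-prime 5≤p with even⊎odd p
... | inj₁ (h , refl) with prime⇒irreducible p-prime (m∣m*n {2} h)
...   | inj₁ ()
...   | inj₂ 2≡p = contradiction (subst (5 ≤_) (sym 2≡p) 5≤p) λ where (s≤s (s≤s ()))
prime≥5⇒odd {p} p-prime 5≤p | inj₂ (h , refl) = h , refl , 2≤h h 5≤p
  where
  2≤h : ∀ h → 5 ≤ 1 + 2 * h → 2 ≤ h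
  2≤h (suc (suc _)) _ = s≤s (s≤s z≤n)
  2≤h 0 (s≤s ())
  2≤h 1 (s≤s (s≤s (s≤s ())))

2*n/2≡n : ∀ n → 2 * n / 2 ≡ n
2*n/2≡n n = trans (cong (_/ 2) (*-comm 2 n)) (m*n/n≡m n 2)

mainTheorem10 : (p : ℕ) → Prime p → 5 ≤ p →
    ((x : ℕ) → IsOption (2 * p) x → SG x ≡ (p ∸ 1) / 2 → x ≡ p + 1)
    × (SG (p + 1) ≡ (p ∸ 1) / 2 → SG (2 * p) ≡ p ∸ 1)
    × (SG (p + 1) ≢ (p ∸ 1) / 2 → SG (2 * p) ≡ (p ∸ 1) / 2)
mainTheorem10 p p-prime 5≤p with h , refl , 2≤h ← prime≥5⇒odd p-prime 5≤p
  rewrite 2*n/2≡n h = SG≡h⇒≡p+1 , SG[2p]≡2h , SG[2p]≡h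
  where open TwicePrime h p-prime 2≤h
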